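{- (1) For all positive integers $m, m_1, m_2$ with $m_1 + m_2 = m$ and all nonnegative integers $k, k_1, k_2$ with $k_1 + k_2 = k-1$, we have $f(m,k) \leq f(m_1,k_1) + f(m_2,k_2)$. (2) Let $m$ be a positive integer and $k$ a nonnegative integer, and suppose $k+1 = am + b$ with integers $a \geq 1$ and $1 \leq b \leq m$. Then $f(m,k) \leq b\,f(a) + (m-b)\,f(a-1)$.
   Context: A tournament is a directed graph obtained by orienting each edge of a complete graph (no loops). In a tournament, a vertex $u$ dominates a set of vertices $U$ (written $u \rightarrow U$) if $(u,w)$ is an edge for every $w \in U$ (in particular $u \notin U$). Let $\tau = \{T_1, \dots, T_m\}$ be a collection of $m$ labeled tournaments, all on the same vertex set $V(\tau)$ (repetitions among the $T_i$ allowed). The collection $\tau$ has Schütte's property $S_k$ if for every $k$-element subset $U \subseteq V(\tau)$ there exist an index $i$ and a vertex $u \in V(\tau)$ with $u \rightarrow U$ in $T_i$. For positive integers $m$ and nonnegative integers $k$, $f(m,k)$ denotes the minimum size of a vertex set $V$ such that there is a collection of $m$ tournaments on $V$ having property $S_k$. For a nonnegative integer $j$, $f(j) = f(1,j)$ is the smallest order of a single tournament with property $S_j$ (so $f(0)=1$). -}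

module Defs where

open import Data.Nat using (ℕ; _≤_; _∸_)
open import Data.Bool using (Bool; true; false; not)
open import Data.Fin using (Fin)
open import Data.Fin.Subset using (Subset; _∈_; ∣_∣)
open import Data.Product using (Σ; ∃; _×_)
open import Relation.Binary.PropositionalEquality using (_≡_; _≢_)

record Tournament (n : ℕ) : Set where
  field
    E      : Fin n → Fin n → Bool
    irrefl : ∀ u → E u u ≡ false
    tourn  : ∀ u v → u ≢ v → E u v ≡ not (E v u)
open Tournament public

Dominates : ∀ {n} → Tournament n → Fin n → Subset n → Set
Dominates T u U = ∀ w → w ∈ U → E T u w ≡ true

Collection : ℕ → ℕ → Set
Collection m n = Fin m → Tournament n

HasS : ∀ {m n} → ℕ → Collection m n → Set
HasS {m} {n} k τ =
  (U : Subset n) → ∣ U ∣ ≡ k → Σ (Fin m) λ i → Σ (Fin n) λ u → Dominates (τ i) u U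

-- There is a collection of m tournaments on an n-element vertex set with
-- property S_k (the vertex set is required to have at least k elements,
-- excluding the degenerate vacuous case).
Admissible : ℕ → ℕ → ℕ → Set
Admissible m k n = k ≤ n × Σ (Collection m n) λ τ → HasS k τ

-- IsF m k n  :  n = f(m,k), the minimum admissible size.
IsF : ℕ → ℕ → ℕ → Set
IsF m k n = Admissible m k n × (∀ n′ → Admissible m k n′ → n ≤ n′)

-- IsF1 j n  :  n = f(j) = f(1,j)
IsF1 : ℕ → ℕ → Set
IsF1 j n = IsF 1 j n

-- Collections τ₁ on V₁ with S_{k₁} and τ₂ on V₂ with S_{k₂} combine into m₁ + m₂
-- tournaments on V₁ ⊔ V₂: each member of τ₁ is extended by all arcs V₁ → V₂ and a
-- fixed member of τ₂ on V₂, each member of τ₂ by all arcs V₂ → V₁ and a fixed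
-- member of τ₁ on V₁. A set of k₁ + k₂ + 1 vertices meets V₁ in at most k₁ or V₂ in
-- at most k₂ vertices, and a collection with S_k dominates every set of at most k
-- vertices, so the combined collection has S_{k₁+k₂+1}. Iterating with b copies of a
-- tournament with S_a and m − b copies of one with S_{a−1} gives (2), because
-- (a + 1) b + a (m − b) = k + 1.
module Submission where

open import Defs
open import Data.Nat using (ℕ; zero; suc; _+_; _*_; _∸_; _≤_; _<_; z≤n; s≤s)
open import Data.Nat.Properties
open import Data.Nat.Tactic.RingSolver using (solve-∀)
open import Data.Bool using (Bool; true; false; not)
open import Data.Bool.Properties using (not-involutive)
open import Data.Fin using (Fin; _↑ˡ_; _↑ʳ_; splitAt; join)
open import Data.Fin.Properties using (splitAt-↑ˡ; splitAt-↑ʳ; join-splitAt; splitAt⁻¹-↑ˡ; splitAt⁻¹-↑ʳ)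
open import Data.Fin.Subset using (Subset; _∈_; ∣_∣; _⊆_; ⊤; ⊥)
open import Data.Fin.Subset.Properties using (∣⊤∣≡n; ∣⊥∣≡0; ∈⊤)
open import Data.Vec using (_∷_; []; _++_; here; there)
import Data.Vec as Vec
open import Data.Vec.Properties using (lookup-++ˡ; lookup-++ʳ; []=⇒lookup; lookup⇒[]=)
open import Data.Sum using (_⊎_; inj₁; inj₂; [_,_]′)
open import Data.Product using (Σ; _×_; _,_; proj₁)
open import Function.Definitions using (Injective)
open import Relation.Binary.PropositionalEquality
open import Relation.Nullary using (yes; no)

private
  variable
    m m₁ m₂ n n₁ n₂ k k₁ k₂ : ℕ

∣++∣ : (xs : Subset n₁) (ys : Subset n₂) → ∣ xs ++ ys ∣ ≡ ∣ xs ∣ + ∣ ys ∣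
∣++∣ []           ys = refl
∣++∣ (true  ∷ xs) ys = cong suc (∣++∣ xs ys)
∣++∣ (false ∷ xs) ys = ∣++∣ xs ys

∈-++⁻ˡ : (xs : Subset n₁) (ys : Subset n₂) (x : Fin n₁) → x ↑ˡ n₂ ∈ xs ++ ys → x ∈ xs
∈-++⁻ˡ xs ys x x∈ = lookup⇒[]= x xs (trans (sym (lookup-++ˡ xs ys x)) ([]=⇒lookup x∈))

∈-++⁻ʳ : (xs : Subset n₁) (ys : Subset n₂) (y : Fin n₂) → n₁ ↑ʳ y ∈ xs ++ ys → y ∈ ys
∈-++⁻ʳ xs ys y y∈ = lookup⇒[]= y ys (trans (sym (lookup-++ʳ xs ys y)) ([]=⇒lookup y∈))

⊆-superset-of-size : (U : Subset n) (k : ℕ) → ∣ U ∣ ≤ k → k ≤ n →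
                     Σ (Subset n) λ U′ → U ⊆ U′ × ∣ U′ ∣ ≡ k
⊆-superset-of-size [] zero _ _ = [] , (λ x∈ → x∈) , refl
⊆-superset-of-size (true ∷ U) (suc k) (s≤s ∣U∣≤k) (s≤s k≤n)
  with U′ , U⊆U′ , ∣U′∣≡k ← ⊆-superset-of-size U k ∣U∣≤k k≤n
  = true ∷ U′ , (λ { here → here ; (there x∈) → there (U⊆U′ x∈) }) , cong suc ∣U′∣≡k
⊆-superset-of-size (false ∷ U) zero ∣U∣≤0 _ = false ∷ U , (λ x∈ → x∈) , n≤0⇒n≡0 ∣U∣≤0
⊆-superset-of-size (false ∷ U) (suc k) ∣U∣≤1+k (s≤s k≤n) with ∣ U ∣ ≤? k
... | no ∣U∣≰k = false ∷ U , (λ x∈ → x∈) , ≤-antisym ∣U∣≤1+k (≰⇒> ∣U∣≰k)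
... | yes ∣U∣≤k with U′ , U⊆U′ , ∣U′∣≡k ← ⊆-superset-of-size U k ∣U∣≤k k≤n
  = true ∷ U′ , (λ { (there x∈) → there (U⊆U′ x∈) }) , cong suc ∣U′∣≡k

+≤+suc⇒≤⊎≤ : ∀ a b → a + b ≤ k₁ + suc k₂ → a ≤ k₁ ⊎ b ≤ k₂
+≤+suc⇒≤⊎≤ {k₁} {k₂} a b a+b≤ with a ≤? k₁
... | yes a≤k₁ = inj₁ a≤k₁
... | no  a≰k₁ = inj₂ (+-cancelˡ-≤ (suc k₁) b k₂ (begin
  suc k₁ + b  ≤⟨ +-monoˡ-≤ b (≰⇒> a≰k₁) ⟩
  a + b       ≤⟨ a+b≤ ⟩
  k₁ + suc k₂ ≡⟨ +-suc k₁ k₂ ⟩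
  suc k₁ + k₂ ∎))
  where open ≤-Reasoning

Dominated : Collection m n → Subset n → Set
Dominated {m} {n} τ U = Σ (Fin m) λ i → Σ (Fin n) λ u → Dominates (τ i) u U

Dominates-⊆ : {T : Tournament n} {u : Fin n} {U U′ : Subset n} →
              U ⊆ U′ → Dominates T u U′ → Dominates T u U
Dominates-⊆ U⊆U′ u→U′ w w∈U = u→U′ w (U⊆U′ w∈U)

HasS⇒Dominated-≤ : {τ : Collection m n} → k ≤ n → HasS k τ →
                   (U : Subset n) → ∣ U ∣ ≤ k → Dominated τ U
HasS⇒Dominated-≤ {τ = τ} k≤n S U ∣U∣≤k
  with U′ , U⊆U′ , ∣U′∣≡k ← ⊆-superset-of-size U _ ∣U∣≤k k≤n
  with i , u , u→U′ ← S U′ ∣U′∣≡k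
  = i , u , Dominates-⊆ {T = τ i} U⊆U′ u→U′

Admissible⇒index : Admissible m k n → Fin m
Admissible⇒index {n = n} (k≤n , τ , S) =
  proj₁ (HasS⇒Dominated-≤ {τ = τ} k≤n S ⊥ (subst (_≤ _) (sym (∣⊥∣≡0 n)) z≤n))

-- No vertex dominates the whole vertex set, since it would dominate itself.
Admissible⇒< : Admissible m k n → k < n
Admissible⇒< {k = k} (k≤n , τ , S) with m≤n⇒m<n∨m≡n k≤n
... | inj₁ k<n = k<n
... | inj₂ refl with i , u , u→V ← S ⊤ (∣⊤∣≡n k)
  with () ← trans (sym (irrefl (τ i) u)) (u→V u ∈⊤)

splitAt-injective : ∀ n₁ n₂ → Injective _≡_ _≡_ (splitAt n₁ {n₂})
splitAt-injective n₁ n₂ {u} {v} eq = begin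
  u                          ≡⟨ join-splitAt n₁ n₂ u ⟨
  join n₁ n₂ (splitAt n₁ u)  ≡⟨ cong (join n₁ n₂) eq ⟩
  join n₁ n₂ (splitAt n₁ v)  ≡⟨ join-splitAt n₁ n₂ v ⟩
  v                          ∎
  where open ≡-Reasoning

module _ (firstBeatsSecond : Bool) (T₁ : Tournament n₁) (T₂ : Tournament n₂) where

  private
    arc : Fin n₁ ⊎ Fin n₂ → Fin n₁ ⊎ Fin n₂ → Bool
    arc (inj₁ x) (inj₁ y) = E T₁ x y
    arc (inj₂ x) (inj₂ y) = E T₂ x y
    arc (inj₁ _) (inj₂ _) = firstBeatsSecond
    arc (inj₂ _) (inj₁ _) = not firstBeatsSecond

    arc-irrefl : ∀ s → arc s s ≡ false
    arc-irrefl (inj₁ x) = irrefl T₁ x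
    arc-irrefl (inj₂ x) = irrefl T₂ x

    arc-tourn : ∀ s t → s ≢ t → arc s t ≡ not (arc t s)
    arc-tourn (inj₁ x) (inj₁ y) s≢t = tourn T₁ x y (λ x≡y → s≢t (cong inj₁ x≡y))
    arc-tourn (inj₂ x) (inj₂ y) s≢t = tourn T₂ x y (λ x≡y → s≢t (cong inj₂ x≡y))
    arc-tourn (inj₁ _) (inj₂ _) _   = sym (not-involutive firstBeatsSecond)
    arc-tourn (inj₂ _) (inj₁ _) _   = refl

  ordinalSum : Tournament (n₁ + n₂)
  ordinalSum = record
    { E      = λ u v → arc (splitAt n₁ u) (splitAt n₁ v)
    ; irrefl = λ u → arc-irrefl (splitAt n₁ u)
    ; tourn  = λ u v u≢v → arc-tourn (splitAt n₁ u) (splitAt n₁ v)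
                             (λ eq → u≢v (splitAt-injective n₁ n₂ eq))
    }

Dominates-↑ˡ : (T₁ : Tournament n₁) (T₂ : Tournament n₂) {u : Fin n₁}
               (xs : Subset n₁) (ys : Subset n₂) →
               Dominates T₁ u xs → Dominates (ordinalSum true T₁ T₂) (u ↑ˡ n₂) (xs ++ ys)
Dominates-↑ˡ {n₁} {n₂} T₁ T₂ {u} xs ys u→xs w w∈
  rewrite splitAt-↑ˡ n₁ u n₂ with splitAt n₁ w in eq
... | inj₁ x = u→xs x (∈-++⁻ˡ xs ys x (subst (_∈ xs ++ ys) (sym (splitAt⁻¹-↑ˡ eq)) w∈))
... | inj₂ _ = refl

Dominates-↑ʳ : (T₁ : Tournament n₁) (T₂ : Tournament n₂) {u : Fin n₂}
               (xs : Subset n₁) (ys : Subset n₂) →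
               Dominates T₂ u ys → Dominates (ordinalSum false T₁ T₂) (n₁ ↑ʳ u) (xs ++ ys)
Dominates-↑ʳ {n₁} {n₂} T₁ T₂ {u} xs ys u→ys w w∈
  rewrite splitAt-↑ʳ n₁ n₂ u with splitAt n₁ w in eq
... | inj₁ _ = refl
... | inj₂ y = u→ys y (∈-++⁻ʳ xs ys y (subst (_∈ xs ++ ys) (sym (splitAt⁻¹-↑ʳ eq)) w∈))

Admissible-+ : Admissible m₁ k₁ n₁ → Admissible m₂ k₂ n₂ → suc k ≡ suc k₁ + suc k₂ →
               Admissible (m₁ + m₂) k (n₁ + n₂)
Admissible-+ {m₁} {k₁} {n₁} {m₂} {k₂} {n₂} A₁@(k₁≤n₁ , τ₁ , S₁) A₂@(k₂≤n₂ , τ₂ , S₂) refl =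
  +-mono-≤ k₁≤n₁ (Admissible⇒< A₂) , τ , S
  where
  τ : Collection (m₁ + m₂) (n₁ + n₂)
  τ i = [ (λ i₁ → ordinalSum true  (τ₁ i₁) (τ₂ (Admissible⇒index A₂)))
          , (λ i₂ → ordinalSum false (τ₁ (Admissible⇒index A₁)) (τ₂ i₂)) ]′ (splitAt m₁ i)

  τ-↑ˡ : ∀ i → τ (i ↑ˡ m₂) ≡ ordinalSum true (τ₁ i) (τ₂ (Admissible⇒index A₂))
  τ-↑ˡ i = cong [ _ , _ ]′ (splitAt-↑ˡ m₁ i m₂)

  τ-↑ʳ : ∀ i → τ (m₁ ↑ʳ i) ≡ ordinalSum false (τ₁ (Admissible⇒index A₁)) (τ₂ i)
  τ-↑ʳ i = cong [ _ , _ ]′ (splitAt-↑ʳ m₁ m₂ i)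

  Dominated-++ : (xs : Subset n₁) (ys : Subset n₂) → ∣ xs ∣ ≤ k₁ ⊎ ∣ ys ∣ ≤ k₂ →
                 Dominated τ (xs ++ ys)
  Dominated-++ xs ys (inj₁ ∣xs∣≤k₁)
    with i , u , u→xs ← HasS⇒Dominated-≤ {τ = τ₁} k₁≤n₁ S₁ xs ∣xs∣≤k₁
    = i ↑ˡ m₂ , u ↑ˡ n₂
    , subst (λ T → Dominates T (u ↑ˡ n₂) (xs ++ ys)) (sym (τ-↑ˡ i)) (Dominates-↑ˡ _ _ xs ys u→xs)
  Dominated-++ xs ys (inj₂ ∣ys∣≤k₂)
    with i , u , u→ys ← HasS⇒Dominated-≤ {τ = τ₂} k₂≤n₂ S₂ ys ∣ys∣≤k₂
    = m₁ ↑ʳ i , n₁ ↑ʳ u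
    , subst (λ T → Dominates T (n₁ ↑ʳ u) (xs ++ ys)) (sym (τ-↑ʳ i)) (Dominates-↑ʳ _ _ xs ys u→ys)

  S : HasS (k₁ + suc k₂) τ
  S U ∣U∣≡k with xs , ys , refl ← Vec.splitAt n₁ U =
    Dominated-++ xs ys (+≤+suc⇒≤⊎≤ ∣ xs ∣ ∣ ys ∣ (≤-reflexive (trans (sym (∣++∣ xs ys)) ∣U∣≡k)))

Admissible-replicate : ∀ j {c} → suc k ≡ suc j * suc c → Admissible 1 c n →
                       Admissible (suc j) k (suc j * n)
Admissible-replicate {k} {n} zero {c} eq A =
  subst₂ (Admissible 1) (sym (suc-injective (trans eq (*-identityˡ (suc c))))) (sym (*-identityˡ n)) A
Admissible-replicate (suc j) eq A = Admissible-+ A (Admissible-replicate j refl A) eq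

f-subadditive : ∀ m m₁ m₂ k k₁ k₂ → m₁ + m₂ ≡ m → suc (k₁ + k₂) ≡ k →
                ∀ n n₁ n₂ → IsF m k n → IsF m₁ k₁ n₁ → IsF m₂ k₂ n₂ → n ≤ n₁ + n₂
f-subadditive _ _ _ _ k₁ k₂ refl refl _ _ _ (_ , minimal) (A₁ , _) (A₂ , _) =
  minimal _ (Admissible-+ A₁ A₂ (cong suc (sym (+-suc k₁ k₂))))

a*[b+r]+b≡b*[1+a]+r*a : ∀ a b r → a * (b + r) + b ≡ b * suc a + r * a
a*[b+r]+b≡b*[1+a]+r*a = solve-∀

f-bound : ∀ m k a b → 1 ≤ a → 1 ≤ b → b ≤ m → suc k ≡ a * m + b →
          ∀ n p q → IsF m k n → IsF1 a p → IsF1 (a ∸ 1) q → n ≤ b * p + (m ∸ b) * q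
f-bound m k (suc a′) (suc b′) _ _ b≤m eq n p q (_ , minimal) (Ap , _) (Aq , _)
  with r , refl ← m≤n⇒∃[o]m+o≡n b≤m
  rewrite m+n∸m≡n (suc b′) r | a*[b+r]+b≡b*[1+a]+r*a (suc a′) (suc b′) r
  with r
... | zero   = subst (n ≤_) (sym (+-identityʳ _))
                 (minimal _ (subst (λ m → Admissible m k (suc b′ * p)) (sym (+-identityʳ (suc b′)))
                   (Admissible-replicate b′ (trans eq (+-identityʳ _)) Ap)))
... | suc i  = minimal _ (Admissible-+ (Admissible-replicate b′ refl Ap) (Admissible-replicate i refl Aq) eq)

theorem2p7 :
    (∀ (m m₁ m₂ k k₁ k₂ : ℕ) → 1 ≤ m₁ → 1 ≤ m₂ → m₁ + m₂ ≡ m → suc (k₁ + k₂) ≡ k →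
      ∀ (n n₁ n₂ : ℕ) → IsF m k n → IsF m₁ k₁ n₁ → IsF m₂ k₂ n₂ →
      n ≤ n₁ + n₂)
    ×
    (∀ (m k a b : ℕ) → 1 ≤ m → 1 ≤ a → 1 ≤ b → b ≤ m → suc k ≡ a * m + b →
      ∀ (n p q : ℕ) → IsF m k n → IsF1 a p → IsF1 (a ∸ 1) q →
      n ≤ b * p + (m ∸ b) * q)
theorem2p7 =
    (λ m m₁ m₂ k k₁ k₂ _ _ → f-subadditive m m₁ m₂ k k₁ k₂)
  , (λ m k a b _ → f-bound m k a b)
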